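{- Let $B=F(b_1,\ldots,b_n)$ be a Ferrers board with $0\le b_1\le\cdots\le b_n$ and $b_n>0$. Then for all positive integers $x$, $$[x+F_{b_1}]_q[x+F_{b_2}]_q\cdots[x+F_{b_n}]_q=\sum_{k=0}^n\mathbf{FT}_k(B,q)\,[x]_q^{n-k}$$ and $$([x]_q+[F_{b_1}]_q)([x]_q+[F_{b_2}]_q)\cdots([x]_q+[F_{b_n}]_q)=\sum_{k=0}^n\overline{\mathbf{FT}}_k(B,q)\,[x]_q^{n-k}.$$
   Context: Fibonacci numbers: $F_0=0$, $F_1=1$, $F_m=F_{m-1}+F_{m-2}$. For an integer $m$, $[m]_q=\frac{1-q^m}{1-q}$ (so $[0]_q=0$). For $m\ge1$, $\mathcal{F}_m$ is the set of tilings of a column of height $m$ (levels $1,\dots,m$ from the bottom) by tiles of heights 1 and 2 whose bottom-most tile has height 1; $\mathcal{F}_0=\emptyset$. For $T\in\mathcal{F}_m$, $\mathrm{rank}_m(T)=\sum F_{i-1}$, the sum over all $i$ such that $T$ has a tile of height 2 occupying levels $i-1$ and $i$. A Ferrers board $F(b_1,\dots,b_n)$ has columns $1,\dots,n$ of heights $b_1\le\cdots\le b_n$. For $0\le k\le n$, $\mathcal{FT}_k(B)$ is the set of Fibonacci file placements: a set $I$ of $k$ columns together with, for each $i\in I$, a tiling $T_i\in\mathcal{F}_{b_i}$ ($k=0$: only the empty placement). For such $P$, $w_{B,q}(P)=q^{\sum_{i\in I}\mathrm{rank}_{b_i}(T_i)+\sum_{j\notin I}F_{b_j}}$ and $\overline{w}_{B,q}(P)=q^{\sum_{i\in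 I}\mathrm{rank}_{b_i}(T_i)}$. Then $\mathbf{FT}_k(B,q)=\sum_{P\in\mathcal{FT}_k(B)}w_{B,q}(P)$ and $\overline{\mathbf{FT}}_k(B,q)=\sum_{P\in\mathcal{FT}_k(B)}\overline{w}_{B,q}(P)$. -}

module Defs where

open import Data.Nat using (ℕ; zero; suc; _+_; _≡ᵇ_)
open import Data.Bool using (Bool; true; false)
open import Data.List using (List; []; _∷_; map; _++_; concatMap; filterᵇ; length; foldr)
open import Data.Maybe using (Maybe; just; nothing)
open import Algebra.Bundles using (CommutativeSemiring)

fib : ℕ → ℕ
fib 0 = 0
fib 1 = 1
fib (suc (suc m)) = fib (suc m) + fib m

data Tile : Set where
  t1 t2 : Tile

-- A tiling of a column is the list of its tiles, listed from the bottom up.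
-- allTilings m : all tilings of a column of height m by tiles of heights 1 and 2.
allTilings : ℕ → List (List Tile)
allTilings 0 = [] ∷ []
allTilings 1 = (t1 ∷ []) ∷ []
allTilings (suc (suc m)) =
  map (t1 ∷_) (allTilings (suc m)) ++ map (t2 ∷_) (allTilings m)

bottomOne : List Tile → Bool
bottomOne (t1 ∷ _) = true
bottomOne _        = false

fibTilings : ℕ → List (List Tile)
fibTilings m = filterᵇ bottomOne (allTilings m)

-- rankFrom p T : T is placed on top of p already-filled levels (so its
-- tiles start at level p+1).  A height-2 tile on levels i-1, i contributes F_{i-1}.
rankFrom : ℕ → List Tile → ℕ
rankFrom p []       = 0
rankFrom p (t1 ∷ T) = rankFrom (suc p) T
rankFrom p (t2 ∷ T) = fib (suc p) + rankFrom (suc (suc p)) T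

rank : List Tile → ℕ
rank T = rankFrom 0 T

-- A Fibonacci file placement on board with column heights b (a list, column 1 first):
-- one entry per column, nothing = column not in I, just T = column in I with tiling T.
Placement : Set
Placement = List (Maybe (List Tile))

placements : List ℕ → List Placement
placements []       = [] ∷ []
placements (b ∷ bs) =
  concatMap (λ P → (nothing ∷ P) ∷ map (λ T → just T ∷ P) (fibTilings b)) (placements bs)

size : Placement → ℕ
size []            = 0
size (nothing ∷ P) = size P
size (just _ ∷ P)  = suc (size P)

placementsₖ : List ℕ → ℕ → List Placement
placementsₖ b k = filterᵇ (λ P → size P ≡ᵇ k) (placements b)

wexp : List ℕ → Placement → ℕ
wexp (b ∷ bs) (nothing ∷ P) = fib b + wexp bs P
wexp (b ∷ bs) (just T ∷ P)  = rank T + wexp bs P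
wexp _ _ = 0

wbarexp : List ℕ → Placement → ℕ
wbarexp (b ∷ bs) (nothing ∷ P) = wbarexp bs P
wbarexp (b ∷ bs) (just T ∷ P)  = rank T + wbarexp bs P
wbarexp _ _ = 0

-- Everything in q lives in an arbitrary commutative semiring (the identities are
-- identities of polynomials in q with natural coefficients).
module _ {c ℓ} (R : CommutativeSemiring c ℓ) where
  open CommutativeSemiring R using (Carrier; 0#; 1#) renaming (_+_ to _⊕_; _*_ to _⊗_)

  pow : Carrier → ℕ → Carrier
  pow q zero    = 1#
  pow q (suc m) = q ⊗ pow q m

  sumR : List Carrier → Carrier
  sumR = foldr _⊕_ 0#

  prodR : List Carrier → Carrier
  prodR = foldr _⊗_ 1#

  qint : Carrier → ℕ → Carrier
  qint q zero    = 0#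
  qint q (suc m) = 1# ⊕ (q ⊗ qint q m)

  FT : Carrier → List ℕ → ℕ → Carrier
  FT q b k = sumR (map (λ P → pow q (wexp b P)) (placementsₖ b k))

  FTbar : Carrier → List ℕ → ℕ → Carrier
  FTbar q b k = sumR (map (λ P → pow q (wbarexp b P)) (placementsₖ b k))

  sumTo : ℕ → (ℕ → Carrier) → Carrier
  sumTo zero    f = f 0
  sumTo (suc n) f = sumTo n f ⊕ f (suc n)

-- Expanding the product column by column, a column of height b contributes either the
-- "empty" term (q^{F_b}[x]_q, resp. [x]_q) or one term q^{rank T} per tiling T ∈ 𝓕_b; the
-- latter sum to [F_b]_q.  Since [x + F_b]_q = q^{F_b}[x]_q + [F_b]_q, the product is the sum
-- over all file placements, and grouping by the number k of used columns gives the formulas.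
-- The identity Σ_{T ∈ 𝓕_m} q^{rank T} = [F_m]_q follows from the q-Fibonacci recurrence
-- [F_{m+2}]_q = [F_{m+1}]_q + q^{F_{m+1}} [F_m]_q, which is the split by the top tile.
module Submission where

open import Defs
open import Data.Nat using (ℕ; zero; suc; _+_; _∸_; _≤_; _<_; _≡ᵇ_; z≤n; s≤s; _≟_)
open import Data.Nat.Properties
  using (+-suc; +-∸-assoc; m≤n⇒m≤1+n; m≤n⇒m<n∨m≡n; ≤-pred; <⇒≤; <⇒≢; >⇒≢; n<1+n)
  renaming (+-comm to ℕ-+-comm)
open import Data.Bool using (true; false; if_then_else_; T?)
import Data.Bool as Bool
open import Data.List using (List; []; _∷_; map; length; last; _++_; concatMap; filterᵇ)
open import Data.List.Properties using (filter-++; filter-all; filter-none; ++-identityʳ)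
open import Data.List.Relation.Unary.All using (All; []; _∷_; universal)
import Data.List.Relation.Unary.All as All
open import Data.List.Relation.Unary.All.Properties using (++⁺; map⁺)
open import Data.List.Relation.Unary.Linked using (Linked)
open import Data.Maybe using (just; nothing)
open import Data.Product using (∃; _×_; _,_)
open import Data.Sum using (inj₁; inj₂)
open import Function using (_∘_)
open import Relation.Binary.PropositionalEquality as ≡ using (_≡_; _≢_)
open import Relation.Nullary.Decidable using (Dec; dec-true; dec-false)
open import Algebra.Bundles using (CommutativeSemiring)
import Algebra.Properties.CommutativeSemigroup as CommSemigroupProperties

extensions : ℕ → Placement → List Placement
extensions b P = (nothing ∷ P) ∷ map (λ T → just T ∷ P) (fibTilings b)

size-placements : ∀ bs → All (λ P → size P ≤ length bs) (placements bs)
size-placements []       = z≤n ∷ []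
size-placements (b ∷ bs) = extend-all (size-placements bs)
  where
  extend-all : ∀ {Ps} → All (λ P → size P ≤ length bs) Ps →
    All (λ P → size P ≤ length (b ∷ bs)) (concatMap (extensions b) Ps)
  extend-all []             = []
  extend-all (s≤n ∷ bounds) = ++⁺ (m≤n⇒m≤1+n s≤n ∷ map⁺ (universal (λ _ → s≤s s≤n) _)) (extend-all bounds)

module _ {c ℓ} (R : CommutativeSemiring c ℓ) where
  open CommutativeSemiring R hiding (zero) renaming (_+_ to _⊕_; _*_ to _⊗_)
  open import Relation.Binary.Reasoning.Setoid setoid
  open CommSemigroupProperties +-commutativeSemigroup
    using () renaming (interchange to +-interchange; xy∙z≈xz∙y to +-xy∙z≈xz∙y)
  open CommSemigroupProperties *-commutativeSemigroup
    using () renaming (interchange to *-interchange; x∙yz≈y∙xz to *-x∙yz≈y∙xz)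

  sumOver : {A : Set} → (A → Carrier) → List A → Carrier
  sumOver f xs = sumR R (map f xs)

  sumOver-map : {A B : Set} (f : B → Carrier) (g : A → B) (xs : List A) →
                sumOver f (map g xs) ≡ sumOver (f ∘ g) xs
  sumOver-map f g []       = ≡.refl
  sumOver-map f g (x ∷ xs) = ≡.cong (f (g x) ⊕_) (sumOver-map f g xs)

  sumOver-++ : {A : Set} (f : A → Carrier) (xs ys : List A) →
               sumOver f (xs ++ ys) ≈ sumOver f xs ⊕ sumOver f ys
  sumOver-++ f []       ys = sym (+-identityˡ _)
  sumOver-++ f (x ∷ xs) ys = trans (+-cong refl (sumOver-++ f xs ys)) (sym (+-assoc _ _ _))

  sumOver-concatMap : {A B : Set} (f : B → Carrier) (g : A → List B) (xs : List A) →
                      sumOver f (concatMap g xs) ≈ sumOver (sumOver f ∘ g) xs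
  sumOver-concatMap f g []       = refl
  sumOver-concatMap f g (x ∷ xs) =
    trans (sumOver-++ f (g x) (concatMap g xs)) (+-cong refl (sumOver-concatMap f g xs))

  sumOver-congᴬ : {A : Set} {f g : A → Carrier} {xs : List A} →
                  All (λ x → f x ≈ g x) xs → sumOver f xs ≈ sumOver g xs
  sumOver-congᴬ []       = refl
  sumOver-congᴬ (p ∷ ps) = +-cong p (sumOver-congᴬ ps)

  sumOver-cong : {A : Set} {f g : A → Carrier} → (∀ x → f x ≈ g x) →
                 (xs : List A) → sumOver f xs ≈ sumOver g xs
  sumOver-cong f≈g xs = sumOver-congᴬ (universal f≈g xs)

  sumOver-*ˡ : {A : Set} (a : Carrier) (f : A → Carrier) (xs : List A) →
               sumOver (λ x → a ⊗ f x) xs ≈ a ⊗ sumOver f xs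
  sumOver-*ˡ a f []       = sym (zeroʳ a)
  sumOver-*ˡ a f (x ∷ xs) = trans (+-cong refl (sumOver-*ˡ a f xs)) (sym (distribˡ _ _ _))

  sumOver-*ʳ : {A : Set} (a : Carrier) (f : A → Carrier) (xs : List A) →
               sumOver (λ x → f x ⊗ a) xs ≈ sumOver f xs ⊗ a
  sumOver-*ʳ a f []       = sym (zeroˡ a)
  sumOver-*ʳ a f (x ∷ xs) = trans (+-cong refl (sumOver-*ʳ a f xs)) (sym (distribʳ _ _ _))

  prodR-map-cong : {A : Set} {f g : A → Carrier} → (∀ x → f x ≈ g x) →
                   (xs : List A) → prodR R (map f xs) ≈ prodR R (map g xs)
  prodR-map-cong f≈g []       = refl
  prodR-map-cong f≈g (x ∷ xs) = *-cong (f≈g x) (prodR-map-cong f≈g xs)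

  sumTo-cong : ∀ n {f g : ℕ → Carrier} → (∀ k → f k ≈ g k) → sumTo R n f ≈ sumTo R n g
  sumTo-cong zero    f≈g = f≈g 0
  sumTo-cong (suc n) f≈g = +-cong (sumTo-cong n f≈g) (f≈g (suc n))

  sumTo-+ : ∀ n (f g : ℕ → Carrier) →
            sumTo R n (λ k → f k ⊕ g k) ≈ sumTo R n f ⊕ sumTo R n g
  sumTo-+ zero    f g = refl
  sumTo-+ (suc n) f g = trans (+-cong (sumTo-+ n f g) refl) (+-interchange _ _ _ _)

  sumTo-0# : ∀ n → sumTo R n (λ _ → 0#) ≈ 0#
  sumTo-0# zero    = refl
  sumTo-0# (suc n) = trans (+-cong (sumTo-0# n) refl) (+-identityˡ 0#)

  -- δ_{s,k} v_k, tested with _≡ᵇ_ as in the filter of placementsₖ.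
  select : ℕ → (ℕ → Carrier) → ℕ → Carrier
  select s v k = if s ≡ᵇ k then v k else 0#

  select-≢ : ∀ s k (v : ℕ → Carrier) → s ≢ k → select s v k ≈ 0#
  select-≢ s k v s≢k rewrite dec-false (s ≟ k) s≢k = refl

  select-self : ∀ s (v : ℕ → Carrier) → select s v s ≈ v s
  select-self s v rewrite dec-true (s ≟ s) ≡.refl = refl

  sumTo-select-below : ∀ n {s} (v : ℕ → Carrier) → n < s → sumTo R n (select s v) ≈ 0#
  sumTo-select-below zero    {s} v 0<s = select-≢ s 0 v (>⇒≢ 0<s)
  sumTo-select-below (suc n) {s} v n<s =
    trans (+-cong (sumTo-select-below n v (<⇒≤ n<s)) (select-≢ s (suc n) v (>⇒≢ n<s)))
          (+-identityˡ 0#)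

  sumTo-select : ∀ n {s} (v : ℕ → Carrier) → s ≤ n → sumTo R n (select s v) ≈ v s
  sumTo-select zero        v z≤n = refl
  sumTo-select (suc n) {s} v s≤1+n with m≤n⇒m<n∨m≡n s≤1+n
  ... | inj₁ s<1+n =
    trans (+-cong (sumTo-select n v (≤-pred s<1+n)) (select-≢ s (suc n) v (<⇒≢ s<1+n)))
          (+-identityʳ _)
  ... | inj₂ ≡.refl =
    trans (+-cong (sumTo-select-below n v (n<1+n n)) (select-self (suc n) v)) (+-identityˡ _)

  sumOver-groupBy : {A : Set} (s : A → ℕ) (f : A → Carrier) (h : ℕ → Carrier) →
    ∀ n {xs} → All (λ x → s x ≤ n) xs →
    sumOver (λ x → f x ⊗ h (s x)) xs ≈ sumTo R n (λ k → sumOver f (filterᵇ (λ x → s x ≡ᵇ k) xs) ⊗ h k)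
  sumOver-groupBy s f h n {[]} [] =
    sym (trans (sumTo-cong n (λ k → zeroˡ (h k))) (sumTo-0# n))
  sumOver-groupBy s f h n {x ∷ xs} (sx≤n ∷ bounds) = begin
    f x ⊗ h (s x) ⊕ sumOver (λ x → f x ⊗ h (s x)) xs
      ≈⟨ +-cong (sym (sumTo-select n v sx≤n)) (sumOver-groupBy s f h n bounds) ⟩
    sumTo R n (select (s x) v) ⊕ sumTo R n (λ k → group xs k ⊗ h k)
      ≈⟨ sym (sumTo-+ n _ _) ⟩
    sumTo R n (λ k → select (s x) v k ⊕ group xs k ⊗ h k)
      ≈⟨ sumTo-cong n group-∷ ⟩
    sumTo R n (λ k → group (x ∷ xs) k ⊗ h k) ∎
    where
    v : ℕ → Carrier
    v k = f x ⊗ h k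
    group : List _ → ℕ → Carrier
    group ys k = sumOver f (filterᵇ (λ y → s y ≡ᵇ k) ys)
    group-∷ : ∀ k → select (s x) v k ⊕ group xs k ⊗ h k ≈ group (x ∷ xs) k ⊗ h k
    group-∷ k with s x ≡ᵇ k
    ... | true  = sym (distribʳ _ _ _)
    ... | false = +-identityˡ _

  module _ (q : Carrier) where

    pow-+ : ∀ a b → pow R q (a + b) ≈ pow R q a ⊗ pow R q b
    pow-+ zero    b = sym (*-identityˡ _)
    pow-+ (suc a) b = trans (*-cong refl (pow-+ a b)) (sym (*-assoc _ _ _))

    qint-+ : ∀ a b → qint R q (a + b) ≈ qint R q a ⊕ pow R q a ⊗ qint R q b
    qint-+ zero    b = sym (trans (+-identityˡ _) (*-identityˡ _))
    qint-+ (suc a) b = begin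
      1# ⊕ q ⊗ qint R q (a + b)                           ≈⟨ +-cong refl (*-cong refl (qint-+ a b)) ⟩
      1# ⊕ q ⊗ (qint R q a ⊕ pow R q a ⊗ qint R q b)       ≈⟨ +-cong refl (distribˡ _ _ _) ⟩
      1# ⊕ (q ⊗ qint R q a ⊕ q ⊗ (pow R q a ⊗ qint R q b)) ≈⟨ sym (+-assoc _ _ _) ⟩
      (1# ⊕ q ⊗ qint R q a) ⊕ q ⊗ (pow R q a ⊗ qint R q b) ≈⟨ +-cong refl (sym (*-assoc _ _ _)) ⟩
      (1# ⊕ q ⊗ qint R q a) ⊕ (q ⊗ pow R q a) ⊗ qint R q b ∎

    qint-+ʳ : ∀ a b → qint R q (a + b) ≈ pow R q b ⊗ qint R q a ⊕ qint R q b
    qint-+ʳ a b = trans (reflexive (≡.cong (qint R q) (ℕ-+-comm a b)))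
                        (trans (qint-+ b a) (+-comm _ _))

    tilingSum : ℕ → ℕ → Carrier
    tilingSum p n = sumOver (λ T → pow R q (rankFrom p T)) (allTilings n)

    tilingSum-bottom : ∀ p n →
      tilingSum p (2 + n) ≈ tilingSum (1 + p) (1 + n) ⊕ pow R q (fib (1 + p)) ⊗ tilingSum (2 + p) n
    tilingSum-bottom p n = begin
      tilingSum p (2 + n)
        ≈⟨ sumOver-++ _ (map (t1 ∷_) (allTilings (1 + n))) (map (t2 ∷_) (allTilings n)) ⟩
      sumOver weight (map (t1 ∷_) (allTilings (1 + n))) ⊕ sumOver weight (map (t2 ∷_) (allTilings n))
        ≡⟨ ≡.cong₂ _⊕_ (sumOver-map weight _ (allTilings (1 + n))) (sumOver-map weight _ (allTilings n)) ⟩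
      tilingSum (1 + p) (1 + n) ⊕ sumOver (λ T → pow R q (fib (1 + p) + rankFrom (2 + p) T)) (allTilings n)
        ≈⟨ +-cong refl (trans (sumOver-cong (λ T → pow-+ (fib (1 + p)) _) (allTilings n))
                              (sumOver-*ˡ _ _ (allTilings n))) ⟩
      tilingSum (1 + p) (1 + n) ⊕ pow R q (fib (1 + p)) ⊗ tilingSum (2 + p) n ∎
      where
      weight : List Tile → Carrier
      weight T = pow R q (rankFrom p T)

    -- The split by the top tile.  Tilings are listed bottom-up, so it is derived from
    -- tilingSum-bottom by induction on n.
    tilingSum-top : ∀ n p →
      tilingSum p (2 + n) ≈ tilingSum p (1 + n) ⊕ pow R q (fib (suc (n + p))) ⊗ tilingSum p n
    tilingSum-top zero          p = tilingSum-bottom p 0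
    -- tilingSum p 0 and tilingSum p 1 are both 1# ⊕ 0#, whatever p.
    tilingSum-top (suc zero)    p = begin
      tilingSum p 3
        ≈⟨ tilingSum-bottom p 1 ⟩
      tilingSum (1 + p) 2 ⊕ a ⊗ tilingSum (2 + p) 1
        ≈⟨ +-cong (tilingSum-bottom (1 + p) 0) refl ⟩
      (tilingSum (2 + p) 1 ⊕ e ⊗ tilingSum (3 + p) 0) ⊕ a ⊗ tilingSum (2 + p) 1
        ≈⟨ +-xy∙z≈xz∙y _ _ _ ⟩
      (tilingSum (2 + p) 1 ⊕ a ⊗ tilingSum (2 + p) 1) ⊕ e ⊗ tilingSum (3 + p) 0
        ≈⟨ +-cong (sym (tilingSum-bottom p 0)) refl ⟩
      tilingSum p 2 ⊕ e ⊗ tilingSum p 1 ∎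
      where
      a e : Carrier
      a = pow R q (fib (1 + p))
      e = pow R q (fib (2 + p))
    tilingSum-top (suc (suc n)) p
      with tilingSum-top (1 + n) (1 + p) | tilingSum-top n (2 + p)
    ... | top₁ | top₂ rewrite +-suc n (1 + p) | +-suc n p = begin
      tilingSum p (4 + n)
        ≈⟨ tilingSum-bottom p (2 + n) ⟩
      tilingSum (1 + p) (3 + n) ⊕ a ⊗ tilingSum (2 + p) (2 + n)
        ≈⟨ +-cong top₁ (*-cong refl top₂) ⟩
      (tilingSum (1 + p) (2 + n) ⊕ e ⊗ tilingSum (1 + p) (1 + n)) ⊕ a ⊗ (tilingSum (2 + p) (1 + n) ⊕ e ⊗ tilingSum (2 + p) n)
        ≈⟨ regroup _ _ _ _ ⟩
      (tilingSum (1 + p) (2 + n) ⊕ a ⊗ tilingSum (2 + p) (1 + n)) ⊕ e ⊗ (tilingSum (1 + p) (1 + n) ⊕ a ⊗ tilingSum (2 + p) n)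
        ≈⟨ sym (+-cong (tilingSum-bottom p (1 + n)) (*-cong refl (tilingSum-bottom p n))) ⟩
      tilingSum p (3 + n) ⊕ e ⊗ tilingSum p (2 + n) ∎
      where
      a e : Carrier
      a = pow R q (fib (1 + p))
      e = pow R q (fib (3 + (n + p)))
      regroup : ∀ X₁ Y₁ X₂ Y₂ →
        (X₁ ⊕ e ⊗ Y₁) ⊕ a ⊗ (X₂ ⊕ e ⊗ Y₂) ≈ (X₁ ⊕ a ⊗ X₂) ⊕ e ⊗ (Y₁ ⊕ a ⊗ Y₂)
      regroup X₁ Y₁ X₂ Y₂ = begin
        (X₁ ⊕ e ⊗ Y₁) ⊕ a ⊗ (X₂ ⊕ e ⊗ Y₂)        ≈⟨ +-cong refl (distribˡ _ _ _) ⟩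
        (X₁ ⊕ e ⊗ Y₁) ⊕ (a ⊗ X₂ ⊕ a ⊗ (e ⊗ Y₂)) ≈⟨ +-interchange _ _ _ _ ⟩
        (X₁ ⊕ a ⊗ X₂) ⊕ (e ⊗ Y₁ ⊕ a ⊗ (e ⊗ Y₂)) ≈⟨ +-cong refl (+-cong refl (*-x∙yz≈y∙xz a e Y₂)) ⟩
        (X₁ ⊕ a ⊗ X₂) ⊕ (e ⊗ Y₁ ⊕ e ⊗ (a ⊗ Y₂)) ≈⟨ +-cong refl (sym (distribˡ _ _ _)) ⟩
        (X₁ ⊕ a ⊗ X₂) ⊕ e ⊗ (Y₁ ⊕ a ⊗ Y₂)        ∎

    tilingSum-one : ∀ n → tilingSum 1 n ≈ qint R q (fib (1 + n))
    tilingSum-one zero          = +-cong refl (sym (zeroʳ q))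
    tilingSum-one (suc zero)    = +-cong refl (sym (zeroʳ q))
    tilingSum-one (suc (suc n)) = begin
      tilingSum 1 (2 + n)
        ≈⟨ tilingSum-top n 1 ⟩
      tilingSum 1 (1 + n) ⊕ pow R q (fib (suc (n + 1))) ⊗ tilingSum 1 n
        ≡⟨ ≡.cong (λ m → tilingSum 1 (1 + n) ⊕ pow R q (fib (suc m)) ⊗ tilingSum 1 n) (ℕ-+-comm n 1) ⟩
      tilingSum 1 (1 + n) ⊕ pow R q (fib (2 + n)) ⊗ tilingSum 1 n
        ≈⟨ +-cong (tilingSum-one (suc n)) (*-cong refl (tilingSum-one n)) ⟩
      qint R q (fib (2 + n)) ⊕ pow R q (fib (2 + n)) ⊗ qint R q (fib (1 + n))
        ≈⟨ sym (qint-+ (fib (2 + n)) (fib (1 + n))) ⟩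
      qint R q (fib (3 + n)) ∎

    fibTilings-suc : ∀ n → fibTilings (suc n) ≡ map (t1 ∷_) (allTilings n)
    fibTilings-suc zero    = ≡.refl
    fibTilings-suc (suc n) =
      ≡.trans (filter-++ bottomOne? starts₁ starts₂)
        (≡.trans (≡.cong₂ _++_ (filter-all bottomOne? (map⁺ (universal _ (allTilings (1 + n)))))
                               (filter-none bottomOne? (map⁺ (universal (λ _ ()) (allTilings n)))))
                 (++-identityʳ starts₁))
      where
      bottomOne? : (T : List Tile) → Dec (Bool.T (bottomOne T))
      bottomOne? = T? ∘ bottomOne
      starts₁ starts₂ : List (List Tile)
      starts₁ = map (t1 ∷_) (allTilings (1 + n))
      starts₂ = map (t2 ∷_) (allTilings n)

    fibTilingSum : ∀ m → sumOver (pow R q ∘ rank) (fibTilings m) ≈ qint R q (fib m)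
    fibTilingSum zero    = refl
    fibTilingSum (suc n) = begin
      sumOver (pow R q ∘ rank) (fibTilings (suc n))          ≡⟨ ≡.cong (sumOver (pow R q ∘ rank)) (fibTilings-suc n) ⟩
      sumOver (pow R q ∘ rank) (map (t1 ∷_) (allTilings n)) ≡⟨ sumOver-map _ _ (allTilings n) ⟩
      tilingSum 1 n                                          ≈⟨ tilingSum-one n ⟩
      qint R q (fib (suc n))                                 ∎

    placementWeight : (ℕ → Carrier) → List ℕ → Placement → Carrier
    placementWeight c (b ∷ bs) (nothing ∷ P) = c b ⊗ placementWeight c bs P
    placementWeight c (b ∷ bs) (just T ∷ P)  = pow R q (rank T) ⊗ placementWeight c bs P
    placementWeight c _        _             = 1#

    pow-wexp : ∀ bs P → pow R q (wexp bs P) ≈ placementWeight (pow R q ∘ fib) bs P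
    pow-wexp []       P             = refl
    pow-wexp (b ∷ bs) []            = refl
    pow-wexp (b ∷ bs) (nothing ∷ P) = trans (pow-+ (fib b) _) (*-cong refl (pow-wexp bs P))
    pow-wexp (b ∷ bs) (just T ∷ P)  = trans (pow-+ (rank T) _) (*-cong refl (pow-wexp bs P))

    pow-wbarexp : ∀ bs P → pow R q (wbarexp bs P) ≈ placementWeight (λ _ → 1#) bs P
    pow-wbarexp []       P             = refl
    pow-wbarexp (b ∷ bs) []            = refl
    pow-wbarexp (b ∷ bs) (nothing ∷ P) = trans (pow-wbarexp bs P) (sym (*-identityˡ _))
    pow-wbarexp (b ∷ bs) (just T ∷ P)  = trans (pow-+ (rank T) _) (*-cong refl (pow-wbarexp bs P))

    module _ (c : ℕ → Carrier) (y : Carrier) where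

      columnFactor : ℕ → Carrier
      columnFactor b = c b ⊗ y ⊕ qint R q (fib b)

      placementTerm : List ℕ → Placement → Carrier
      placementTerm bs P = placementWeight c bs P ⊗ pow R y (length bs ∸ size P)

      placements-extend : ∀ b bs P → size P ≤ length bs →
        sumOver (placementTerm (b ∷ bs)) (extensions b P) ≈ columnFactor b ⊗ placementTerm bs P
      placements-extend b bs P s≤n = begin
        placementTerm (b ∷ bs) (nothing ∷ P) ⊕ sumOver (placementTerm (b ∷ bs)) (map (λ T → just T ∷ P) (fibTilings b))
          ≡⟨ ≡.cong₂ _⊕_ (≡.cong (λ m → c b ⊗ w ⊗ pow R y m) (+-∸-assoc 1 s≤n)) (sumOver-map _ _ (fibTilings b)) ⟩
        (c b ⊗ w) ⊗ (y ⊗ yⁿ) ⊕ sumOver (λ T → (pow R q (rank T) ⊗ w) ⊗ yⁿ) (fibTilings b)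
          ≈⟨ +-cong (*-interchange _ _ _ _) (trans (sumOver-cong (λ T → *-assoc _ _ _) (fibTilings b))
                                                  (sumOver-*ʳ _ _ (fibTilings b))) ⟩
        (c b ⊗ y) ⊗ (w ⊗ yⁿ) ⊕ sumOver (pow R q ∘ rank) (fibTilings b) ⊗ (w ⊗ yⁿ)
          ≈⟨ +-cong refl (*-cong (fibTilingSum b) refl) ⟩
        (c b ⊗ y) ⊗ (w ⊗ yⁿ) ⊕ qint R q (fib b) ⊗ (w ⊗ yⁿ)
          ≈⟨ sym (distribʳ _ _ _) ⟩
        columnFactor b ⊗ placementTerm bs P ∎
        where
        w yⁿ : Carrier
        w  = placementWeight c bs P
        yⁿ = pow R y (length bs ∸ size P)

      product-as-placementSum : ∀ bs →
        prodR R (map columnFactor bs) ≈ sumOver (placementTerm bs) (placements bs)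
      product-as-placementSum []       = sym (trans (+-identityʳ _) (*-identityʳ _))
      product-as-placementSum (b ∷ bs) = begin
        columnFactor b ⊗ prodR R (map columnFactor bs)
          ≈⟨ *-cong refl (product-as-placementSum bs) ⟩
        columnFactor b ⊗ sumOver (placementTerm bs) (placements bs)
          ≈⟨ sym (sumOver-*ˡ (columnFactor b) _ (placements bs)) ⟩
        sumOver (λ P → columnFactor b ⊗ placementTerm bs P) (placements bs)
          ≈⟨ sumOver-congᴬ (All.map (λ {P} → sym ∘ placements-extend b bs P) (size-placements bs)) ⟩
        sumOver (sumOver (placementTerm (b ∷ bs)) ∘ extensions b) (placements bs)
          ≈⟨ sym (sumOver-concatMap _ (extensions b) (placements bs)) ⟩
        sumOver (placementTerm (b ∷ bs)) (placements (b ∷ bs)) ∎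

      product-expansion : (e : List ℕ → Placement → ℕ) → (∀ bs P → pow R q (e bs P) ≈ placementWeight c bs P) →
        ∀ bs → prodR R (map columnFactor bs)
             ≈ sumTo R (length bs) (λ k → sumOver (pow R q ∘ e bs) (placementsₖ bs k) ⊗ pow R y (length bs ∸ k))
      product-expansion e pow-e bs = begin
        prodR R (map columnFactor bs)
          ≈⟨ product-as-placementSum bs ⟩
        sumOver (placementTerm bs) (placements bs)
          ≈⟨ sumOver-cong (λ P → *-cong (sym (pow-e bs P)) refl) (placements bs) ⟩
        sumOver (λ P → pow R q (e bs P) ⊗ pow R y (length bs ∸ size P)) (placements bs)
          ≈⟨ sumOver-groupBy size (pow R q ∘ e bs) (λ k → pow R y (length bs ∸ k)) (length bs) (size-placements bs) ⟩
        sumTo R (length bs) (λ k → sumOver (pow R q ∘ e bs) (placementsₖ bs k) ⊗ pow R y (length bs ∸ k)) ∎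

theorem5 : ∀ {c ℓ} (R : CommutativeSemiring c ℓ) (b : List ℕ) →
    Linked _≤_ b → (∃ λ m → last b ≡ just (suc m)) →
    (x : ℕ) → 0 < x → (q : CommutativeSemiring.Carrier R) →
    CommutativeSemiring._≈_ R
      (prodR R (map (λ bi → qint R q (x + fib bi)) b))
      (sumTo R (length b) (λ k → CommutativeSemiring._*_ R (FT R q b k) (pow R (qint R q x) (length b ∸ k))))
    ×
    CommutativeSemiring._≈_ R
      (prodR R (map (λ bi → CommutativeSemiring._+_ R (qint R q x) (qint R q (fib bi))) b))
      (sumTo R (length b) (λ k → CommutativeSemiring._*_ R (FTbar R q b k) (pow R (qint R q x) (length b ∸ k))))
theorem5 R b _ _ x _ q =
  trans (prodR-map-cong R (λ bᵢ → qint-+ʳ R q x (fib bᵢ)) b)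
        (product-expansion R q (pow R q ∘ fib) (qint R q x) wexp (pow-wexp R q) b) ,
  trans (prodR-map-cong R (λ _ → +-cong (sym (*-identityˡ _)) refl) b)
        (product-expansion R q (λ _ → 1#) (qint R q x) wbarexp (pow-wbarexp R q) b)
  where open CommutativeSemiring R
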